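{- Let $0<\varepsilon<1/3$ be a constant and let $k\le n/100$. Let $t=\lfloor k/\lfloor 1/\varepsilon\rfloor\rfloor$. Consider a fixed set $T'=\{u_1,\dots,u_t\}$ of terminals and a fixed set $A$ of $n-k$ Steiner vertices, and let $V'=T'\cup A$. Sample a metric $w'$ on $V'$ as follows: choose a uniformly random injective map $i\mapsto x_i$ from $[t]$ into $A$ (equivalently a uniformly random $t$-subset $X\subseteq A$ together with a uniformly random bijection from $X$ to $[t]$); set $w'(u_i,x_i)=1$ for each $i\in[t]$ (these pairs are called crucial edges), and set $w'(v,v')=2$ for every other pair of distinct points $v,v'\in V'$. Then any deterministic algorithm which, by querying values of $w'$, discovers in expectation at least $\varepsilon^2k/2$ crucial edges performs at least $\Omega(\varepsilon^2nk)$ queries in expectation.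
   Context: An algorithm knows $V'$, $T'$ and $A$, and accesses $w'$ only through queries returning $w'(v,v')$ for a chosen pair. A crucial edge $(u,x)$ is said to be discovered by the algorithm at some step if the answers to the queries performed up to that step uniquely identify $(u,x)$ as a crucial edge (i.e., determine that $w'(u,x)=1$).
   Formalization: The constant ε ranges only over the rationals. -}

module Defs where

open import Data.Nat as ℕ using (ℕ; zero; suc; _+_; _∸_)
import Data.Nat.DivMod as ℕD
open import Data.Integer as ℤ using (ℤ)
open import Data.Rational as ℚ using (ℚ; ↥_; ↧ₙ_)
open import Data.Fin as Fin using (Fin)
import Data.Fin.Properties as FinP
open import Data.Vec as Vec using (Vec; []; _∷_; lookup)
open import Data.List as List using (List; []; _∷_; length; map; concatMap; filter; allFin; cartesianProduct)
open import Data.List.Relation.Unary.Unique.Propositional using (Unique)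
import Data.List.Relation.Unary.Unique.DecPropositional as UD
import Data.Bool.ListAction as BL
import Data.Nat.ListAction as NL
open import Data.List.Relation.Unary.All using (All; all?)
open import Data.Sum using (_⊎_; inj₁; inj₂)
open import Data.Product using (_×_; _,_; proj₁; proj₂)
open import Relation.Binary.PropositionalEquality using (_≡_)
open import Relation.Nullary.Decidable using (does; ⌊_⌋)
open import Data.Bool using (Bool; true; false; if_then_else_)

-- natural-number division, with the (irrelevant here) convention d = 0 ↦ 0
_div_ : ℕ → ℕ → ℕ
k div zero = 0
k div suc d = k ℕD./ suc d

-- ⌊ 1/ε ⌋ for a positive rational ε = p/q (p = numerator, q = denominator):
-- ⌊ q/p ⌋
floorInv : ℚ → ℕ
floorInv ε = (↧ₙ ε) div (ℤ.∣ ↥ ε ∣)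

tOf : ℚ → ℕ → ℕ
tOf ε k = k div floorInv ε

-- Point set V' = T' ∪ A with T' = {u_1..u_t} (inj₁) and A of size m (inj₂)
V' : ℕ → ℕ → Set
V' t m = Fin t ⊎ Fin m

allVecs : (t m : ℕ) → List (Vec (Fin m) t)
allVecs zero m = [] ∷ []
allVecs (suc t) m = concatMap (λ v → map (λ a → a ∷ v) (allFin m)) (allVecs t m)

-- all injective maps [t] → A, i ↦ x_i, represented as vectors with distinct entries
injections : (t m : ℕ) → List (Vec (Fin m) t)
injections t m = List.filterᵇ (λ v → does (UD.unique? FinP._≟_ (Vec.toList v))) (allVecs t m)

_=ᶠ_ : ∀ {m} → Fin m → Fin m → Bool
a =ᶠ b = does (a FinP.≟ b)

w' : ∀ {t m} → Vec (Fin m) t → V' t m → V' t m → ℕ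
w' σ (inj₁ i) (inj₂ a) = if a =ᶠ lookup σ i then 1 else 2
w' σ (inj₂ a) (inj₁ i) = if a =ᶠ lookup σ i then 1 else 2
w' σ (inj₁ i) (inj₁ j) = if i =ᶠ j then 0 else 2
w' σ (inj₂ a) (inj₂ b) = if a =ᶠ b then 0 else 2

-- A deterministic (adaptive) query algorithm: a decision tree which either
-- stops or queries w'(v,v') and continues depending on the answer.
data Alg (V : Set) : Set where
  stop  : Alg V
  query : V → V → (ℕ → Alg V) → Alg V

queries : ∀ {t m} → Alg (V' t m) → Vec (Fin m) t → List (V' t m × V' t m)
queries stop σ = []
queries (query v v' k) σ = (v , v') ∷ queries (k (w' σ v v')) σ

numQueries : ∀ {t m} → Alg (V' t m) → Vec (Fin m) t → ℕ
numQueries alg σ = length (queries alg σ)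

consistent : ∀ {t m} → List (V' t m × V' t m) → Vec (Fin m) t → Vec (Fin m) t → Bool
consistent qs σ τ = ⌊ all? (λ p → w' τ (proj₁ p) (proj₂ p) ℕ.≟ w' σ (proj₁ p) (proj₂ p)) qs ⌋

-- (u_i , a) is discovered on σ: every metric in the support consistent
-- with the answers has w'(u_i,a) = 1 (i.e. τ(i) = a)
discoveredB : ∀ {t m} → Alg (V' t m) → Vec (Fin m) t → Fin t × Fin m → Bool
discoveredB {t} {m} alg σ (i , a) =
  BL.all (λ τ → if consistent (queries alg σ) σ τ then lookup τ i =ᶠ a else true)
           (injections t m)

numDiscovered : ∀ {t m} → Alg (V' t m) → Vec (Fin m) t → ℕ
numDiscovered {t} {m} alg σ =
  length (List.filterᵇ (discoveredB alg σ) (cartesianProduct (allFin t) (allFin m)))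

sumInj : (t m : ℕ) → (Vec (Fin m) t → ℕ) → ℕ
sumInj t m f = NL.sum (map f (injections t m))

-- expectation of f under the uniform distribution on injective maps, as a rational
-- (the sample space is nonempty whenever t ≤ m)
expect : (t m : ℕ) → (Vec (Fin m) t → ℕ) → ℚ
expect t m f with length (injections t m)
... | zero  = ℚ.0ℚ
... | suc N = (ℤ.+ sumInj t m f) ℚ./ suc N

ℕtoℚ : ℕ → ℚ
ℕtoℚ n = (ℤ.+ n) ℚ./ 1

-- Fix an injection σ : [t] → A (|A| = m = n − k), a terminal i and a Steiner point a outside
-- the image of σ, and let τ = σ[i ≔ a]. The metrics of σ and τ differ only on the pairs
-- (u_i, a) and (u_i, σ i), so the runs of the algorithm on σ and on τ coincide until one of
-- them asks such a pair. Hence if (u_i, σ i) is discovered on σ, then for each of the at least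
-- m − t choices of a, either the run on σ asks (u_i, a) or the run on τ asks (u_i, σ i).
-- Summed over σ, the two alternatives are equally frequent, because (a, σ) ↦ (σ i, τ) is an
-- involution on injections [t+1] → A; and a query asks at most one crucial pair. So
-- (m − t)·Σ discovered ≤ 2·Σ queries, and m − t ≥ 4n/5 turns the assumed ε²k/2 expected
-- discoveries into ε²nk/5 expected queries.

module Submission where

open import Defs
open import Algebra.Properties.CommutativeSemigroup using (interchange)
open import Data.Bool.Base using (Bool; true; false; _∧_; _∨_; T; if_then_else_)
import Data.Bool.ListAction as Bool
open import Data.Empty using (⊥-elim)
open import Data.Fin.Base using (Fin; zero; suc)
open import Data.Fin.Permutation.Components using (transpose; transpose-inverse)
import Data.Fin.Properties as FinP
open import Data.List.Base as List using (List; []; _∷_; _++_; map; concatMap; length; filterᵇ; cartesianProduct; allFin)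
open import Data.List.Membership.Propositional using (_∈_)
open import Data.List.Membership.Propositional.Properties using (∈-map⁺; ∈-concatMap⁺; ∈-allFin; ∈-filter⁺; ∈-filter⁻)
import Data.List.Properties as List
open import Data.List.Relation.Unary.All as All using (All; []; _∷_)
open import Data.List.Relation.Unary.All.Properties using (all⁺)
open import Data.List.Relation.Unary.AllPairs using ([]; _∷_)
open import Data.List.Relation.Unary.Any as Any using (Any; here; there)
open import Data.List.Relation.Unary.Any.Properties using (any⁺)
open import Data.List.Relation.Unary.Unique.Propositional using (Unique)
import Data.List.Relation.Unary.Unique.DecPropositional as UD
open import Data.Nat.Base as ℕ using (ℕ; zero; suc; _+_; _*_; _∸_; _≤_; z≤n; s≤s)
open import Data.Nat.DivMod using (m/n≤m)
open import Data.Nat.ListAction using (sum)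
open import Data.Nat.ListAction.Properties using (sum-++)
open import Data.Nat.Properties
open import Data.Product.Base using (∃; _×_; _,_; proj₁; proj₂)
open import Data.Sum.Base as Sum using (_⊎_; inj₁; inj₂)
open import Data.Vec.Base as Vec using (Vec; []; _∷_; lookup; _[_]≔_)
import Data.Vec.Properties as VecP
import Data.Vec.Relation.Unary.All.Properties as VecAll
open import Data.Vec.Relation.Unary.AllPairs using ([]; _∷_)
import Data.Vec.Relation.Unary.Unique.Propositional as VecUnique
import Data.Vec.Relation.Unary.Unique.Propositional.Properties as VecUniqueP
open import Function.Base using (_∘_; id)
open import Function.Bundles using (mk⇔)
open import Relation.Binary.Definitions using (DecidableEquality)
open import Relation.Binary.PropositionalEquality
open import Relation.Nullary.Decidable using (Dec; does; yes; no; _×-dec_; does-⇔; dec-false; T?; toWitness; fromWitness; isYes≗does)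
open import Relation.Nullary.Negation using (¬_)

-- Sums over lists

⟦_⟧ : Bool → ℕ
⟦ true ⟧ = 1
⟦ false ⟧ = 0

⟦∧⟧ : ∀ x y → ⟦ x ∧ y ⟧ ≡ ⟦ x ⟧ * ⟦ y ⟧
⟦∧⟧ true y = sym (+-identityʳ ⟦ y ⟧)
⟦∧⟧ false y = refl

⟦∨⟧ : ∀ x y → ⟦ x ∨ y ⟧ ≤ ⟦ x ⟧ + ⟦ y ⟧
⟦∨⟧ true y = s≤s z≤n
⟦∨⟧ false y = ≤-refl

⟦⟧-¬T : ∀ {x} → ¬ T x → ⟦ x ⟧ ≡ 0
⟦⟧-¬T {true}  ¬t = ⊥-elim (¬t _)
⟦⟧-¬T {false} _  = refl

⟦⟧+⟦⟧-≥1 : ∀ {x y} → T x ⊎ T y → 1 ≤ ⟦ x ⟧ + ⟦ y ⟧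
⟦⟧+⟦⟧-≥1 {true}         _        = s≤s z≤n
⟦⟧+⟦⟧-≥1 {false} {true} _        = s≤s z≤n
⟦⟧+⟦⟧-≥1 {false} {false} (inj₁ ())
⟦⟧+⟦⟧-≥1 {false} {false} (inj₂ ())

⟦⟧-≤-⟦⟧* : ∀ x n → (T x → 1 ≤ n) → ⟦ x ⟧ ≤ ⟦ x ⟧ * n
⟦⟧-≤-⟦⟧* true  n 1≤n = ≤-trans (1≤n _) (≤-reflexive (sym (+-identityʳ n)))
⟦⟧-≤-⟦⟧* false n _   = z≤n

*-⟦⟧-≤ : ∀ x n k → (T x → n ≤ k) → n * ⟦ x ⟧ ≤ k
*-⟦⟧-≤ true  n k n≤k = ≤-trans (≤-reflexive (*-identityʳ n)) (n≤k _)
*-⟦⟧-≤ false n k _   = ≤-trans (≤-reflexive (*-zeroʳ n)) z≤n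

⟦⟧*-≤ : ∀ x n → ⟦ x ⟧ * n ≤ n
⟦⟧*-≤ true n = ≤-reflexive (+-identityʳ n)
⟦⟧*-≤ false n = z≤n

T-does⁺ : ∀ {P : Set} (P? : Dec P) → P → T (does P?)
T-does⁺ P? p = subst T (isYes≗does P?) (fromWitness p)

T-does⁻ : ∀ {P : Set} (P? : Dec P) → T (does P?) → P
T-does⁻ P? t = toWitness (subst T (sym (isYes≗does P?)) t)

∑ : {A : Set} → List A → (A → ℕ) → ℕ
∑ xs f = sum (map f xs)

infix 5 ∑
syntax ∑ xs (λ x → e) = ∑[ x ∈ xs ] e

module _ {A : Set} where

  ∑-cong : ∀ (xs : List A) {f g : A → ℕ} → (∀ x → f x ≡ g x) → ∑ xs f ≡ ∑ xs g
  ∑-cong []       f≗g = refl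
  ∑-cong (x ∷ xs) f≗g = cong₂ _+_ (f≗g x) (∑-cong xs f≗g)

  ∑-mono-∈ : ∀ (xs : List A) {f g : A → ℕ} → (∀ {x} → x ∈ xs → f x ≤ g x) → ∑ xs f ≤ ∑ xs g
  ∑-mono-∈ []       f≤g = z≤n
  ∑-mono-∈ (x ∷ xs) f≤g = +-mono-≤ (f≤g (here refl)) (∑-mono-∈ xs (f≤g ∘ there))

  ∑-mono : ∀ (xs : List A) {f g : A → ℕ} → (∀ x → f x ≤ g x) → ∑ xs f ≤ ∑ xs g
  ∑-mono xs f≤g = ∑-mono-∈ xs (λ {x} _ → f≤g x)

  ∑-zero : ∀ (xs : List A) → ∑[ x ∈ xs ] 0 ≡ 0
  ∑-zero []       = refl
  ∑-zero (x ∷ xs) = ∑-zero xs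

  ∑-one : ∀ (xs : List A) → ∑[ x ∈ xs ] 1 ≡ length xs
  ∑-one []       = refl
  ∑-one (x ∷ xs) = cong ℕ.suc (∑-one xs)

  ∑-distrib-+ : ∀ (xs : List A) (f g : A → ℕ) → ∑[ x ∈ xs ] (f x + g x) ≡ ∑ xs f + ∑ xs g
  ∑-distrib-+ []       f g = refl
  ∑-distrib-+ (x ∷ xs) f g =
    trans (cong (f x + g x +_) (∑-distrib-+ xs f g)) (interchange +-commutativeSemigroup (f x) (g x) (∑ xs f) (∑ xs g))

  *-distribˡ-∑ : ∀ c (xs : List A) (f : A → ℕ) → c * ∑ xs f ≡ ∑[ x ∈ xs ] c * f x
  *-distribˡ-∑ c []       f = *-zeroʳ c
  *-distribˡ-∑ c (x ∷ xs) f = trans (*-distribˡ-+ c (f x) _) (cong (c * f x +_) (*-distribˡ-∑ c xs f))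

  ∑-++ : ∀ (xs ys : List A) (f : A → ℕ) → ∑ (xs ++ ys) f ≡ ∑ xs f + ∑ ys f
  ∑-++ xs ys f = trans (cong sum (List.map-++ f xs ys)) (sum-++ (map f xs) (map f ys))

  ∑-filterᵇ : ∀ (p : A → Bool) (xs : List A) (f : A → ℕ) → ∑ (filterᵇ p xs) f ≡ ∑[ x ∈ xs ] ⟦ p x ⟧ * f x
  ∑-filterᵇ p []       f = refl
  ∑-filterᵇ p (x ∷ xs) f with p x
  ... | true  = cong₂ _+_ (sym (+-identityʳ (f x))) (∑-filterᵇ p xs f)
  ... | false = ∑-filterᵇ p xs f

  length-filterᵇ : ∀ (p : A → Bool) (xs : List A) → length (filterᵇ p xs) ≡ ∑[ x ∈ xs ] ⟦ p x ⟧
  length-filterᵇ p []       = refl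
  length-filterᵇ p (x ∷ xs) with p x
  ... | true  = cong ℕ.suc (length-filterᵇ p xs)
  ... | false = length-filterᵇ p xs

  ∑-any-≤-length : ∀ {B : Set} (xs : List A) (p : A → B → Bool) →
                   (∀ q → ∑[ x ∈ xs ] ⟦ p x q ⟧ ≤ 1) →
                   ∀ qs → ∑[ x ∈ xs ] ⟦ Bool.any (p x) qs ⟧ ≤ length qs
  ∑-any-≤-length xs p single []       = ≤-reflexive (∑-zero xs)
  ∑-any-≤-length xs p single (q ∷ qs) = begin
    ∑[ x ∈ xs ] ⟦ p x q ∨ Bool.any (p x) qs ⟧           ≤⟨ ∑-mono xs (λ x → ⟦∨⟧ (p x q) _) ⟩
    ∑[ x ∈ xs ] (⟦ p x q ⟧ + ⟦ Bool.any (p x) qs ⟧)     ≡⟨ ∑-distrib-+ xs _ _ ⟩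
    (∑[ x ∈ xs ] ⟦ p x q ⟧) + (∑[ x ∈ xs ] ⟦ Bool.any (p x) qs ⟧)
                                                        ≤⟨ +-mono-≤ (single q) (∑-any-≤-length xs p single qs) ⟩
    suc (length qs)                                     ∎
    where open ≤-Reasoning

∑-map : ∀ {A B : Set} (g : A → B) (xs : List A) (f : B → ℕ) → ∑ (map g xs) f ≡ ∑ xs (f ∘ g)
∑-map g xs f = cong sum (sym (List.map-∘ xs))

module _ {A B : Set} where

  ∑-concatMap : ∀ (g : A → List B) (xs : List A) (f : B → ℕ) →
                ∑ (concatMap g xs) f ≡ ∑[ x ∈ xs ] ∑ (g x) f
  ∑-concatMap g []       f = refl
  ∑-concatMap g (x ∷ xs) f = trans (∑-++ (g x) _ f) (cong (∑ (g x) f +_) (∑-concatMap g xs f))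

  ∑-cartesianProduct : ∀ (xs : List A) (ys : List B) (f : A × B → ℕ) →
                       ∑ (cartesianProduct xs ys) f ≡ ∑[ x ∈ xs ] ∑[ y ∈ ys ] f (x , y)
  ∑-cartesianProduct []       ys f = refl
  ∑-cartesianProduct (x ∷ xs) ys f =
    trans (∑-++ (map (x ,_) ys) _ f) (cong₂ _+_ (∑-map (x ,_) ys f) (∑-cartesianProduct xs ys f))

  ∑-comm : ∀ (xs : List A) (ys : List B) (f : A → B → ℕ) →
           ∑[ x ∈ xs ] ∑ ys (f x) ≡ ∑[ y ∈ ys ] ∑[ x ∈ xs ] f x y
  ∑-comm []       ys f = sym (∑-zero ys)
  ∑-comm (x ∷ xs) ys f = trans (cong (∑ ys (f x) +_) (∑-comm xs ys f)) (sym (∑-distrib-+ ys (f x) _))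

-- Enumerations

module Enumeration {A : Set} (_≟_ : DecidableEquality A) where

  open import Data.List.Membership.DecPropositional _≟_ using (_∈?_)
  open import Data.List.Relation.Unary.All.Properties using (¬Any⇒All¬)
  open import Relation.Nullary.Decidable using (dec-true)

  δ : A → A → ℕ
  δ x z = ⟦ does (x ≟ z) ⟧

  record Enumerates (ys : List A) : Set where
    constructor enumerates
    field once : ∀ z → ∑[ y ∈ ys ] δ y z ≡ 1

  δ-*-subst : ∀ y z (f : A → ℕ) → δ y z * f y ≡ δ y z * f z
  δ-*-subst y z f with y ≟ z
  ... | yes refl = refl
  ... | no _     = refl

  module _ {ys : List A} (enum : Enumerates ys) where

    open Enumerates enum

    ∑-δ : ∀ z (f : A → ℕ) → ∑[ y ∈ ys ] δ y z * f y ≡ f z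
    ∑-δ z f = begin
      ∑[ y ∈ ys ] δ y z * f y   ≡⟨ ∑-cong ys (λ y → trans (δ-*-subst y z f) (*-comm _ (f z))) ⟩
      ∑[ y ∈ ys ] f z * δ y z   ≡⟨ *-distribˡ-∑ (f z) ys (λ y → δ y z) ⟨
      f z * (∑[ y ∈ ys ] δ y z) ≡⟨ cong (f z *_) (once z) ⟩
      f z * 1                   ≡⟨ *-identityʳ (f z) ⟩
      f z                       ∎
      where open ≡-Reasoning

    ∑-involution : ∀ (φ : A → A) → (∀ x → φ (φ x) ≡ x) → ∀ (f : A → ℕ) → ∑[ x ∈ ys ] f (φ x) ≡ ∑ ys f
    ∑-involution φ φ∘φ≗id f = begin
      ∑[ x ∈ ys ] f (φ x)                       ≡⟨ ∑-cong ys (λ x → ∑-δ (φ x) f) ⟨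
      ∑[ x ∈ ys ] ∑[ y ∈ ys ] δ y (φ x) * f y   ≡⟨ ∑-comm ys ys _ ⟩
      ∑[ y ∈ ys ] ∑[ x ∈ ys ] δ y (φ x) * f y   ≡⟨ ∑-cong ys (λ y → ∑-cong ys (λ x → cong (_* f y) (δ-flip x y))) ⟩
      ∑[ y ∈ ys ] ∑[ x ∈ ys ] δ x (φ y) * f y   ≡⟨ ∑-cong ys (λ y → ∑-δ (φ y) (λ _ → f y)) ⟩
      ∑ ys f                                    ∎
      where
      open ≡-Reasoning
      δ-flip : ∀ x y → δ y (φ x) ≡ δ x (φ y)
      δ-flip x y with y ≟ φ x | x ≟ φ y
      ... | yes _    | yes _   = refl
      ... | no _     | no _    = refl
      ... | yes refl | no x≢   = ⊥-elim (x≢ (sym (φ∘φ≗id x)))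
      ... | no y≢    | yes refl = ⊥-elim (y≢ (sym (φ∘φ≗id y)))

    ∑-∈?-≤-length : ∀ xs → ∑[ y ∈ ys ] ⟦ does (y ∈? xs) ⟧ ≤ length xs
    ∑-∈?-≤-length []       = ≤-reflexive (∑-zero ys)
    ∑-∈?-≤-length (x ∷ xs) = begin
      ∑[ y ∈ ys ] ⟦ does (y ≟ x) ∨ does (y ∈? xs) ⟧         ≤⟨ ∑-mono ys (λ y → ⟦∨⟧ (does (y ≟ x)) _) ⟩
      ∑[ y ∈ ys ] (δ y x + ⟦ does (y ∈? xs) ⟧)               ≡⟨ ∑-distrib-+ ys _ _ ⟩
      (∑[ y ∈ ys ] δ y x) + (∑[ y ∈ ys ] ⟦ does (y ∈? xs) ⟧) ≤⟨ +-mono-≤ (≤-reflexive (once x)) (∑-∈?-≤-length xs) ⟩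
      suc (length xs)                                        ∎
      where open ≤-Reasoning

    length∸length≤∑-unique-∷ : ∀ {xs} → Unique xs →
                               length ys ∸ length xs ≤ ∑[ y ∈ ys ] ⟦ does (UD.unique? _≟_ (y ∷ xs)) ⟧
    length∸length≤∑-unique-∷ {xs} xs! = m≤n+o⇒m∸n≤o (length ys) (length xs) (begin
      length ys                                                     ≡⟨ ∑-one ys ⟨
      ∑[ y ∈ ys ] 1                                                 ≤⟨ ∑-mono ys new-or-old ⟩
      ∑[ y ∈ ys ] (⟦ does (y ∈? xs) ⟧ + ⟦ unique-∷? y ⟧)            ≡⟨ ∑-distrib-+ ys _ _ ⟩
      (∑[ y ∈ ys ] ⟦ does (y ∈? xs) ⟧) + (∑[ y ∈ ys ] ⟦ unique-∷? y ⟧) ≤⟨ +-monoˡ-≤ _ (∑-∈?-≤-length xs) ⟩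
      length xs + (∑[ y ∈ ys ] ⟦ unique-∷? y ⟧)                      ∎)
      where
      open ≤-Reasoning
      unique-∷? : A → Bool
      unique-∷? y = does (UD.unique? _≟_ (y ∷ xs))
      new-or-old : ∀ y → 1 ≤ ⟦ does (y ∈? xs) ⟧ + ⟦ unique-∷? y ⟧
      new-or-old y with y ∈? xs
      ... | yes _ = s≤s z≤n
      ... | no y∉xs rewrite dec-true (UD.unique? _≟_ (y ∷ xs)) (¬Any⇒All¬ xs y∉xs ∷ xs!) = s≤s z≤n

module FinEnumeration {n : ℕ} = Enumeration (FinP._≟_ {n})

∑-allFin-suc : ∀ {n} (f : Fin (suc n) → ℕ) → ∑ (allFin (suc n)) f ≡ f zero + ∑ (allFin n) (f ∘ suc)
∑-allFin-suc f = cong (λ xs → f zero + sum xs) (trans (List.map-tabulate suc f) (sym (List.map-tabulate id (f ∘ suc))))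

allFin-enumerates : ∀ n → FinEnumeration.Enumerates (allFin n)
allFin-enumerates n = FinEnumeration.enumerates (once n)
  where
  open FinEnumeration using (δ)
  once : ∀ n (z : Fin n) → ∑[ y ∈ allFin n ] δ y z ≡ 1
  once (suc n) zero    = trans (∑-allFin-suc {n} (λ y → δ y zero)) (cong ℕ.suc (∑-zero (allFin n)))
  once (suc n) (suc z) = trans (∑-allFin-suc {n} (λ y → δ y (suc z))) (once n z)

module VecEnumeration {m n : ℕ} = Enumeration (VecP.≡-dec {n = n} (FinP._≟_ {m}))

module _ {m : ℕ} where

  ∑-allVecs-suc : ∀ n (g : Vec (Fin m) (suc n) → ℕ) →
                  ∑ (allVecs (suc n) m) g ≡ ∑[ σ ∈ allVecs n m ] ∑[ a ∈ allFin m ] g (a ∷ σ)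
  ∑-allVecs-suc n g = trans (∑-concatMap _ (allVecs n m) g) (∑-cong (allVecs n m) (λ σ → ∑-map (_∷ σ) (allFin m) g))

  allVecs-enumerates : ∀ n → VecEnumeration.Enumerates (allVecs n m)
  allVecs-enumerates n = VecEnumeration.enumerates (once n)
    where
    open FinEnumeration using (δ)
    open VecEnumeration renaming (δ to δᵥ)
    once : ∀ n (z : Vec (Fin m) n) → ∑[ v ∈ allVecs n m ] δᵥ v z ≡ 1
    once zero    []      = refl
    once (suc n) (b ∷ w) = begin
      ∑[ v ∈ allVecs (suc n) m ] δᵥ v (b ∷ w)                    ≡⟨ ∑-allVecs-suc n _ ⟩
      ∑[ σ ∈ allVecs n m ] ∑[ a ∈ allFin m ] δᵥ (a ∷ σ) (b ∷ w)  ≡⟨ ∑-cong (allVecs n m) (λ σ → ∑-cong (allFin m) (λ a →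
                                                                    ⟦∧⟧ (does (a FinP.≟ b)) (does (VecP.≡-dec FinP._≟_ σ w)))) ⟩
      ∑[ σ ∈ allVecs n m ] ∑[ a ∈ allFin m ] δ a b * δᵥ σ w      ≡⟨ ∑-cong (allVecs n m) (λ σ →
                                                                    FinEnumeration.∑-δ (allFin-enumerates m) b (λ _ → δᵥ σ w)) ⟩
      ∑[ σ ∈ allVecs n m ] δᵥ σ w                                 ≡⟨ once n w ⟩
      1                                                           ∎
      where open ≡-Reasoning

  ∈-allVecs : ∀ {n} (v : Vec (Fin m) n) → v ∈ allVecs n m
  ∈-allVecs []      = here refl
  ∈-allVecs (a ∷ v) = ∈-concatMap⁺ _ (Any.map (λ { refl → ∈-map⁺ (_∷ v) (∈-allFin a) }) (∈-allVecs v))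

-- Injections [t] → Fin m

swapHead : ∀ {A : Set} {t} → Fin t → Vec A (suc t) → Vec A (suc t)
swapHead i (a ∷ σ) = lookup σ i ∷ (σ [ i ]≔ a)

module _ {A : Set} {t : ℕ} (i : Fin t) where

  swapHead-involutive : ∀ (v : Vec A (suc t)) → swapHead i (swapHead i v) ≡ v
  swapHead-involutive (a ∷ σ) =
    cong₂ _∷_ (VecP.lookup∘update i σ a) (trans (VecP.[]≔-idempotent σ i) (VecP.[]≔-lookup σ i))

  lookup-swapHead : ∀ (v : Vec A (suc t)) k → lookup (swapHead i v) k ≡ lookup v (transpose zero (suc i) k)
  lookup-swapHead (a ∷ σ) zero    = refl
  lookup-swapHead (a ∷ σ) (suc j) with j FinP.≟ i
  ... | yes refl = VecP.lookup∘update j σ a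
  ... | no j≢i   = VecP.lookup∘update′ j≢i σ a

module _ {A : Set} where

  toList-unique⁺ : ∀ {n} {v : Vec A n} → VecUnique.Unique v → Unique (Vec.toList v)
  toList-unique⁺ []         = []
  toList-unique⁺ (v∌x ∷ v!) = VecAll.toList⁺ v∌x ∷ toList-unique⁺ v!

  toList-unique⁻ : ∀ {n} {v : Vec A n} → Unique (Vec.toList v) → VecUnique.Unique v
  toList-unique⁻ {v = []}    []         = []
  toList-unique⁻ {v = x ∷ v} (v∌x ∷ v!) = VecAll.toList⁻ v∌x ∷ toList-unique⁻ v!

module _ {m : ℕ} where

  Injection : ∀ {n} → Vec (Fin m) n → Set
  Injection σ = Unique (Vec.toList σ)

  isInjection : ∀ {n} → Vec (Fin m) n → Bool
  isInjection σ = does (UD.unique? FinP._≟_ (Vec.toList σ))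

  isInjection⁺ : ∀ {n} {σ : Vec (Fin m) n} → Injection σ → T (isInjection σ)
  isInjection⁺ {σ = σ} = T-does⁺ (UD.unique? FinP._≟_ (Vec.toList σ))

  isInjection⁻ : ∀ {n} {σ : Vec (Fin m) n} → T (isInjection σ) → Injection σ
  isInjection⁻ {σ = σ} = T-does⁻ (UD.unique? FinP._≟_ (Vec.toList σ))

  Injection-∷⁻ : ∀ {n a} {σ : Vec (Fin m) n} → Injection (a ∷ σ) → Injection σ
  Injection-∷⁻ (_ ∷ σ!) = σ!

  Injection-head-∉ : ∀ {n a} {σ : Vec (Fin m) n} → Injection (a ∷ σ) → ∀ i → a ≢ lookup σ i
  Injection-head-∉ aσ! i a≡σi with VecUniqueP.lookup-injective (toList-unique⁻ aσ!) zero (suc i) a≡σi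
  ... | ()

  module _ {t : ℕ} (i : Fin t) where

    Injection-swapHead : ∀ {v : Vec (Fin m) (suc t)} → Injection v → Injection (swapHead i v)
    Injection-swapHead {v} v! =
      toList-unique⁺ (subst VecUnique.Unique (VecP.tabulate∘lookup (swapHead i v)) (VecUniqueP.tabulate⁺ injective))
      where
      π : Fin (suc t) → Fin (suc t)
      π = transpose zero (suc i)
      injective : ∀ {j l} → lookup (swapHead i v) j ≡ lookup (swapHead i v) l → j ≡ l
      injective {j} {l} e = begin
        j                           ≡⟨ transpose-inverse (suc i) zero ⟨
        transpose (suc i) zero (π j) ≡⟨ cong (transpose (suc i) zero) (VecUniqueP.lookup-injective (toList-unique⁻ v!) (π j) (π l)
                                          (trans (sym (lookup-swapHead i v j)) (trans e (lookup-swapHead i v l)))) ⟩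
        transpose (suc i) zero (π l) ≡⟨ transpose-inverse (suc i) zero ⟩
        l                           ∎
        where open ≡-Reasoning

    isInjection-swapHead : ∀ (v : Vec (Fin m) (suc t)) → isInjection (swapHead i v) ≡ isInjection v
    isInjection-swapHead v = does-⇔ (mk⇔ (subst Injection (swapHead-involutive i v) ∘ Injection-swapHead) Injection-swapHead)
                               (UD.unique? FinP._≟_ _) (UD.unique? FinP._≟_ _)

module _ {t m : ℕ} where

  ∈-injections⁺ : ∀ {σ : Vec (Fin m) t} → Injection σ → σ ∈ injections t m
  ∈-injections⁺ {σ} σ! = ∈-filter⁺ (T? ∘ isInjection) (∈-allVecs σ) (isInjection⁺ σ!)

  ∈-injections⁻ : ∀ {σ : Vec (Fin m) t} → σ ∈ injections t m → Injection σ
  ∈-injections⁻ σ∈ = isInjection⁻ (proj₂ (∈-filter⁻ (T? ∘ isInjection) {xs = allVecs t m} σ∈))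

  ∑-injections : ∀ (f : Vec (Fin m) t → ℕ) → ∑ (injections t m) f ≡ ∑[ σ ∈ allVecs t m ] ⟦ isInjection σ ⟧ * f σ
  ∑-injections = ∑-filterᵇ isInjection (allVecs t m)

∑-injections-suc : ∀ {t m} (h : Vec (Fin m) (suc t) → ℕ) →
                   ∑ (injections (suc t) m) h ≡ ∑[ σ ∈ injections t m ] ∑[ a ∈ allFin m ] ⟦ isInjection (a ∷ σ) ⟧ * h (a ∷ σ)
∑-injections-suc {t} {m} h = begin
  ∑ (injections (suc t) m) h                               ≡⟨ ∑-injections h ⟩
  ∑[ ρ ∈ allVecs (suc t) m ] ⟦ isInjection ρ ⟧ * h ρ       ≡⟨ ∑-allVecs-suc t _ ⟩
  ∑[ σ ∈ allVecs t m ] extensions σ                        ≡⟨ ∑-cong (allVecs t m) extensions-need-injection ⟩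
  ∑[ σ ∈ allVecs t m ] ⟦ isInjection σ ⟧ * extensions σ    ≡⟨ ∑-injections extensions ⟨
  ∑ (injections t m) extensions                            ∎
  where
  open ≡-Reasoning
  extensions : Vec (Fin m) t → ℕ
  extensions σ = ∑[ a ∈ allFin m ] ⟦ isInjection (a ∷ σ) ⟧ * h (a ∷ σ)
  extensions-need-injection : ∀ σ → extensions σ ≡ ⟦ isInjection σ ⟧ * extensions σ
  extensions-need-injection σ = by-cases (isInjection σ) refl
    where
    by-cases : ∀ b → isInjection σ ≡ b → extensions σ ≡ ⟦ b ⟧ * extensions σ
    by-cases true  _  = sym (+-identityʳ _)
    by-cases false σ? = trans (∑-cong (allFin m) (λ a → cong (λ b → ⟦ b ⟧ * h (a ∷ σ)) (no-extension a))) (∑-zero (allFin m))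
      where
      no-extension : ∀ a → isInjection (a ∷ σ) ≡ false
      no-extension a = dec-false (UD.unique? FinP._≟_ (Vec.toList (a ∷ σ)))
                                 (λ aσ! → subst T σ? (isInjection⁺ (Injection-∷⁻ aσ!)))

∑-injections-swapHead : ∀ {t m} (i : Fin t) (h : Vec (Fin m) (suc t) → ℕ) →
                        ∑[ ρ ∈ injections (suc t) m ] h (swapHead i ρ) ≡ ∑ (injections (suc t) m) h
∑-injections-swapHead {t} {m} i h = begin
  ∑[ ρ ∈ injections (suc t) m ] h (swapHead i ρ)                                   ≡⟨ ∑-injections (h ∘ swapHead i) ⟩
  ∑[ ρ ∈ allVecs (suc t) m ] ⟦ isInjection ρ ⟧ * h (swapHead i ρ)                  ≡⟨ ∑-cong (allVecs (suc t) m) (λ ρ →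
                                                                                        cong (λ b → ⟦ b ⟧ * h (swapHead i ρ)) (isInjection-swapHead i ρ)) ⟨
  ∑[ ρ ∈ allVecs (suc t) m ] ⟦ isInjection (swapHead i ρ) ⟧ * h (swapHead i ρ)     ≡⟨ VecEnumeration.∑-involution (allVecs-enumerates (suc t))
                                                                                        (swapHead i) (swapHead-involutive i) (λ ρ → ⟦ isInjection ρ ⟧ * h ρ) ⟩
  ∑[ ρ ∈ allVecs (suc t) m ] ⟦ isInjection ρ ⟧ * h ρ                               ≡⟨ ∑-injections h ⟨
  ∑ (injections (suc t) m) h                                                       ∎
  where open ≡-Reasoning

injective-extensions-≥ : ∀ {n m} {σ : Vec (Fin m) n} → Injection σ → m ∸ n ≤ ∑[ a ∈ allFin m ] ⟦ isInjection (a ∷ σ) ⟧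
injective-extensions-≥ {n} {m} {σ} σ! =
  subst₂ (λ m′ n′ → m′ ∸ n′ ≤ ∑[ a ∈ allFin m ] ⟦ isInjection (a ∷ σ) ⟧) (List.length-tabulate id) (VecP.length-toList σ)
         (FinEnumeration.length∸length≤∑-unique-∷ (allFin-enumerates m) σ!)

-- Runs of a query algorithm

module _ {t m : ℕ} where

  joins : Fin t × Fin m → V' t m × V' t m → Bool
  joins (i , a) (inj₁ j , inj₂ b) = does ((i FinP.≟ j) ×-dec (a FinP.≟ b))
  joins (i , a) (inj₂ b , inj₁ j) = does ((i FinP.≟ j) ×-dec (a FinP.≟ b))
  joins _       (inj₁ _ , inj₁ _) = false
  joins _       (inj₂ _ , inj₂ _) = false

  edges : List (Fin t × Fin m)
  edges = cartesianProduct (allFin t) (allFin m)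

  ∑-joins-≤-1 : ∀ q → ∑[ e ∈ edges ] ⟦ joins e q ⟧ ≤ 1
  ∑-joins-≤-1 (inj₁ j , inj₂ b) = ≤-reflexive (∑-joins-crucial j b)
    where
    open FinEnumeration using (δ; ∑-δ; Enumerates)
    ∑-joins-crucial : ∀ j b → ∑[ e ∈ edges ] ⟦ joins e (inj₁ j , inj₂ b) ⟧ ≡ 1
    ∑-joins-crucial j b = begin
      ∑[ e ∈ edges ] ⟦ joins e (inj₁ j , inj₂ b) ⟧  ≡⟨ ∑-cartesianProduct (allFin t) (allFin m) _ ⟩
      ∑[ i ∈ allFin t ] ∑[ a ∈ allFin m ] ⟦ does (i FinP.≟ j) ∧ does (a FinP.≟ b) ⟧
                                                    ≡⟨ ∑-cong (allFin t) (λ i → ∑-cong (allFin m) (λ a →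
                                                         trans (⟦∧⟧ (does (i FinP.≟ j)) _) (*-comm (δ i j) (δ a b)))) ⟩
      ∑[ i ∈ allFin t ] ∑[ a ∈ allFin m ] δ a b * δ i j
                                                    ≡⟨ ∑-cong (allFin t) (λ i → ∑-δ (allFin-enumerates m) b (λ _ → δ i j)) ⟩
      ∑[ i ∈ allFin t ] δ i j                       ≡⟨ Enumerates.once (allFin-enumerates t) j ⟩
      1                                             ∎
      where open ≡-Reasoning
  ∑-joins-≤-1 (inj₂ b , inj₁ j) = ∑-joins-≤-1 (inj₁ j , inj₂ b)
  ∑-joins-≤-1 (inj₁ _ , inj₁ _) = ≤-trans (≤-reflexive (∑-zero edges)) z≤n
  ∑-joins-≤-1 (inj₂ _ , inj₂ _) = ≤-trans (≤-reflexive (∑-zero edges)) z≤n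

  asks : Alg (V' t m) → Vec (Fin m) t → Fin t × Fin m → Bool
  asks alg σ e = Bool.any (joins e) (queries alg σ)

  ∑-asks-≤-numQueries : ∀ alg σ → ∑[ e ∈ edges ] ⟦ asks alg σ e ⟧ ≤ numQueries alg σ
  ∑-asks-≤-numQueries alg σ = ∑-any-≤-length edges joins ∑-joins-≤-1 (queries alg σ)

  Agrees : Vec (Fin m) t → Vec (Fin m) t → V' t m × V' t m → Set
  Agrees σ τ q = w' τ (proj₁ q) (proj₂ q) ≡ w' σ (proj₁ q) (proj₂ q)

  module _ {σ τ : Vec (Fin m) t} (M N : V' t m × V' t m → Bool)
           (agree : ∀ q → ¬ T (M q) → ¬ T (N q) → Agrees σ τ q) where

    -- The two runs coincide until one of them asks a pair on which the metrics may differ.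
    lockstep : ∀ alg → Any (T ∘ M) (queries alg σ) ⊎ Any (T ∘ N) (queries alg τ) ⊎ All (Agrees σ τ) (queries alg σ)
    lockstep stop = inj₂ (inj₂ [])
    lockstep (query v v′ k) with T? (M (v , v′)) | T? (N (v , v′))
    ... | yes Mq | _     = inj₁ (here Mq)
    ... | no _   | yes Nq = inj₂ (inj₁ (here Nq))
    ... | no ¬Mq | no ¬Nq with agree (v , v′) ¬Mq ¬Nq
    ...   | same rewrite same = Sum.map there (Sum.map there (same ∷_)) (lockstep (k (w' σ v v′)))

  Agrees-update-crucial : ∀ σ i a j b → ¬ T (joins (i , a) (inj₁ j , inj₂ b)) → ¬ T (joins (i , lookup σ i) (inj₁ j , inj₂ b)) →
                          Agrees σ (σ [ i ]≔ a) (inj₁ j , inj₂ b)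
  Agrees-update-crucial σ i a j b ¬ia ¬iσi with j FinP.≟ i
  ... | no j≢i   rewrite VecP.lookup∘update′ j≢i σ a = refl
  ... | yes refl rewrite VecP.lookup∘update i σ a
                       | dec-false (b FinP.≟ a) (λ b≡a → ¬ia (T-does⁺ ((i FinP.≟ i) ×-dec (a FinP.≟ b)) (refl , sym b≡a)))
                       | dec-false (b FinP.≟ lookup σ i)
                           (λ b≡σi → ¬iσi (T-does⁺ ((i FinP.≟ i) ×-dec (lookup σ i FinP.≟ b)) (refl , sym b≡σi))) = refl

  Agrees-update : ∀ σ i a q → ¬ T (joins (i , a) q) → ¬ T (joins (i , lookup σ i) q) → Agrees σ (σ [ i ]≔ a) q
  Agrees-update σ i a (inj₁ j , inj₂ b) = Agrees-update-crucial σ i a j b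
  Agrees-update σ i a (inj₂ b , inj₁ j) = Agrees-update-crucial σ i a j b
  Agrees-update σ i a (inj₁ _ , inj₁ _) _ _ = refl
  Agrees-update σ i a (inj₂ _ , inj₂ _) _ _ = refl

  discovered-forces : ∀ alg σ τ i a → T (discoveredB alg σ (i , a)) → Injection τ → All (Agrees σ τ) (queries alg σ) →
                      lookup τ i ≡ a
  discovered-forces alg σ τ i a discovered τ! agreeing =
    T-does⁻ (lookup τ i FinP.≟ a) (if-true (fromWitness agreeing) (All.lookup (all⁺ _ (injections t m) discovered) (∈-injections⁺ τ!)))
    where
    if-true : ∀ {b c} → T b → T (if b then c else true) → T c
    if-true {true} _ c = c

  discovered-crucial : ∀ alg σ i a → T (discoveredB alg σ (i , a)) → Injection σ → lookup σ i ≡ a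
  discovered-crucial alg σ i a discovered σ! = discovered-forces alg σ σ i a discovered σ! (All.universal (λ _ → refl) _)

  discovery-needs-query : ∀ alg σ i a → Injection (a ∷ σ) → T (discoveredB alg σ (i , lookup σ i)) →
                          T (asks alg σ (i , a)) ⊎ T (asks alg (σ [ i ]≔ a) (i , lookup σ i))
  discovery-needs-query alg σ i a aσ! discovered
    with lockstep (joins (i , a)) (joins (i , lookup σ i)) (Agrees-update σ i a) alg
  ... | inj₁ asked               = inj₁ (any⁺ _ asked)
  ... | inj₂ (inj₁ asked)        = inj₂ (any⁺ _ asked)
  ... | inj₂ (inj₂ agreeing)   = ⊥-elim (Injection-head-∉ aσ! i (begin
    a                         ≡⟨ VecP.lookup∘update i σ a ⟨
    lookup (σ [ i ]≔ a) i     ≡⟨ discovered-forces alg σ (σ [ i ]≔ a) i _ discovered τ! agreeing ⟩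
    lookup σ i                ∎))
    where
    open ≡-Reasoning
    τ! : Injection (σ [ i ]≔ a)
    τ! = Injection-∷⁻ (Injection-swapHead i aσ!)

  asksHead : Alg (V' t m) → Fin t → Vec (Fin m) (suc t) → ℕ
  asksHead alg i ρ = ⟦ asks alg (Vec.tail ρ) (i , Vec.head ρ) ⟧

  -- asksHead alg i (swapHead i (a ∷ σ)) records whether the run on σ [ i ]≔ a asks (u_i , σ i).
  swapQueries : Alg (V' t m) → Vec (Fin m) t → Fin t → ℕ
  swapQueries alg σ i = ∑[ a ∈ allFin m ] ⟦ isInjection (a ∷ σ) ⟧ * (asksHead alg i (a ∷ σ) + asksHead alg i (swapHead i (a ∷ σ)))

  ∑-discovered-at : ∀ alg σ i → Injection σ →
                    ∑[ a ∈ allFin m ] ⟦ discoveredB alg σ (i , a) ⟧ ≡ ⟦ discoveredB alg σ (i , lookup σ i) ⟧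
  ∑-discovered-at alg σ i σ! =
    trans (∑-cong (allFin m) only-crucial) (FinEnumeration.∑-δ (allFin-enumerates m) (lookup σ i) (λ a → ⟦ discoveredB alg σ (i , a) ⟧))
    where
    only-crucial : ∀ a → ⟦ discoveredB alg σ (i , a) ⟧ ≡ FinEnumeration.δ a (lookup σ i) * ⟦ discoveredB alg σ (i , a) ⟧
    only-crucial a with a FinP.≟ lookup σ i | T? (discoveredB alg σ (i , a))
    ... | yes _   | _       = sym (+-identityʳ _)
    ... | no _    | no ¬d   = ⟦⟧-¬T ¬d
    ... | no a≢σi | yes d   = ⊥-elim (a≢σi (sym (discovered-crucial alg σ i a d σ!)))

  discoveries-≤-swapQueries : ∀ alg σ i → Injection σ →
                              (m ∸ t) * (∑[ a ∈ allFin m ] ⟦ discoveredB alg σ (i , a) ⟧) ≤ swapQueries alg σ i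
  discoveries-≤-swapQueries alg σ i σ! = begin
    (m ∸ t) * (∑[ a ∈ allFin m ] ⟦ discoveredB alg σ (i , a) ⟧)  ≡⟨ cong ((m ∸ t) *_) (∑-discovered-at alg σ i σ!) ⟩
    (m ∸ t) * ⟦ discoveredB alg σ (i , lookup σ i) ⟧            ≤⟨ *-⟦⟧-≤ _ (m ∸ t) _ (λ discovered → begin
      m ∸ t                                        ≤⟨ injective-extensions-≥ σ! ⟩
      ∑[ a ∈ allFin m ] ⟦ isInjection (a ∷ σ) ⟧    ≤⟨ ∑-mono (allFin m) (λ a → ⟦⟧-≤-⟦⟧* _ _ (λ aσ! →
                                                       ⟦⟧+⟦⟧-≥1 (discovery-needs-query alg σ i a (isInjection⁻ aσ!) discovered))) ⟩
      swapQueries alg σ i                          ∎) ⟩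
    swapQueries alg σ i                                          ∎
    where open ≤-Reasoning

  ∑-swapQueries : ∀ alg i → ∑[ σ ∈ injections t m ] swapQueries alg σ i ≤ 2 * (∑[ σ ∈ injections t m ] ∑[ a ∈ allFin m ] ⟦ asks alg σ (i , a) ⟧)
  ∑-swapQueries alg i = begin
    ∑[ σ ∈ injections t m ] swapQueries alg σ i                     ≡⟨ ∑-injections-suc (λ ρ → h ρ + h (swapHead i ρ)) ⟨
    ∑[ ρ ∈ injections (suc t) m ] (h ρ + h (swapHead i ρ))          ≡⟨ ∑-distrib-+ (injections (suc t) m) h (h ∘ swapHead i) ⟩
    ∑ (injections (suc t) m) h + (∑[ ρ ∈ injections (suc t) m ] h (swapHead i ρ))
                                                                     ≡⟨ cong (∑ (injections (suc t) m) h +_) (∑-injections-swapHead i h) ⟩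
    ∑ (injections (suc t) m) h + ∑ (injections (suc t) m) h          ≡⟨ cong (∑ (injections (suc t) m) h +_) (+-identityʳ _) ⟨
    2 * ∑ (injections (suc t) m) h                                   ≡⟨ cong (2 *_) (∑-injections-suc h) ⟩
    2 * (∑[ σ ∈ injections t m ] ∑[ a ∈ allFin m ] ⟦ isInjection (a ∷ σ) ⟧ * h (a ∷ σ))
                                                                     ≤⟨ *-monoʳ-≤ 2 (∑-mono (injections t m) (λ σ →
                                                                          ∑-mono (allFin m) (λ a → ⟦⟧*-≤ (isInjection (a ∷ σ)) _))) ⟩
    2 * (∑[ σ ∈ injections t m ] ∑[ a ∈ allFin m ] ⟦ asks alg σ (i , a) ⟧) ∎
    where
    open ≤-Reasoning
    h : Vec (Fin m) (suc t) → ℕ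
    h = asksHead alg i

  numDiscovered-≡ : ∀ alg σ → numDiscovered alg σ ≡ ∑[ i ∈ allFin t ] ∑[ a ∈ allFin m ] ⟦ discoveredB alg σ (i , a) ⟧
  numDiscovered-≡ alg σ = trans (length-filterᵇ (discoveredB alg σ) edges) (∑-cartesianProduct (allFin t) (allFin m) _)

  queries-≥-discoveries : ∀ alg → (m ∸ t) * sumInj t m (numDiscovered alg) ≤ 2 * sumInj t m (numQueries alg)
  queries-≥-discoveries alg = begin
    (m ∸ t) * sumInj t m (numDiscovered alg)                           ≡⟨ *-distribˡ-∑ (m ∸ t) (injections t m) _ ⟩
    ∑[ σ ∈ injections t m ] (m ∸ t) * numDiscovered alg σ              ≡⟨ ∑-cong (injections t m) (λ σ →
                                                                           trans (cong ((m ∸ t) *_) (numDiscovered-≡ alg σ)) (*-distribˡ-∑ (m ∸ t) (allFin t) _)) ⟩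
    ∑[ σ ∈ injections t m ] ∑[ i ∈ allFin t ] (m ∸ t) * (∑[ a ∈ allFin m ] ⟦ discoveredB alg σ (i , a) ⟧)
                                                                       ≤⟨ ∑-mono-∈ (injections t m) (λ σ∈ → ∑-mono (allFin t) (λ i →
                                                                           discoveries-≤-swapQueries alg _ i (∈-injections⁻ σ∈))) ⟩
    ∑[ σ ∈ injections t m ] ∑[ i ∈ allFin t ] swapQueries alg σ i      ≡⟨ ∑-comm (injections t m) (allFin t) _ ⟩
    ∑[ i ∈ allFin t ] ∑[ σ ∈ injections t m ] swapQueries alg σ i      ≤⟨ ∑-mono (allFin t) (∑-swapQueries alg) ⟩
    ∑[ i ∈ allFin t ] 2 * (∑[ σ ∈ injections t m ] ∑[ a ∈ allFin m ] ⟦ asks alg σ (i , a) ⟧)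
                                                                       ≡⟨ *-distribˡ-∑ 2 (allFin t) _ ⟨
    2 * (∑[ i ∈ allFin t ] ∑[ σ ∈ injections t m ] ∑[ a ∈ allFin m ] ⟦ asks alg σ (i , a) ⟧)
                                                                       ≡⟨ cong (2 *_) (∑-comm (allFin t) (injections t m) _) ⟩
    2 * (∑[ σ ∈ injections t m ] ∑[ i ∈ allFin t ] ∑[ a ∈ allFin m ] ⟦ asks alg σ (i , a) ⟧)
                                                                       ≡⟨ cong (2 *_) (∑-cong (injections t m) (λ σ →
                                                                           ∑-cartesianProduct (allFin t) (allFin m) (λ e → ⟦ asks alg σ e ⟧))) ⟨
    2 * (∑[ σ ∈ injections t m ] ∑[ e ∈ edges ] ⟦ asks alg σ e ⟧)      ≤⟨ *-monoʳ-≤ 2 (∑-mono (injections t m) (∑-asks-≤-numQueries alg)) ⟩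
    2 * sumInj t m (numQueries alg)                                    ∎
    where open ≤-Reasoning

-- The expected number of queries

div-≤ : ∀ k d → k div d ≤ k
div-≤ k zero    = z≤n
div-≤ k (suc d) = m/n≤m k (suc d)

4n≤5[n∸k∸t] : ∀ n k t → 100 * k ≤ n → t ≤ k → 4 * n ≤ 5 * (n ∸ k ∸ t)
4n≤5[n∸k∸t] n k t 100k≤n t≤k = begin
  4 * n                ≤⟨ m+n≤o⇒m≤o∸n (4 * n) 4n+10k≤5n ⟩
  5 * n ∸ 5 * (k + k)  ≡⟨ *-distribˡ-∸ 5 n (k + k) ⟨
  5 * (n ∸ (k + k))    ≡⟨ cong (5 *_) (∸-+-assoc n k k) ⟨
  5 * (n ∸ k ∸ k)      ≤⟨ *-monoʳ-≤ 5 (∸-monoʳ-≤ (n ∸ k) t≤k) ⟩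
  5 * (n ∸ k ∸ t)      ∎
  where
  open ≤-Reasoning
  4n+10k≤5n : 4 * n + 5 * (k + k) ≤ 5 * n
  4n+10k≤5n = begin
    4 * n + 5 * (k + k)  ≡⟨ cong (4 * n +_) (trans (*-distribˡ-+ 5 k k) (sym (*-distribʳ-+ k 5 5))) ⟩
    4 * n + 10 * k       ≤⟨ +-monoʳ-≤ (4 * n) (≤-trans (*-monoˡ-≤ k (m≤m+n 10 90)) 100k≤n) ⟩
    4 * n + n            ≡⟨ +-comm (4 * n) n ⟩
    5 * n                ∎

4n*discovered≤10*queries : ∀ n k t → 100 * k ≤ n → t ≤ k → (alg : Alg (V' t (n ∸ k))) →
                           4 * n * sumInj t (n ∸ k) (numDiscovered alg) ≤ 10 * sumInj t (n ∸ k) (numQueries alg)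
4n*discovered≤10*queries n k t 100k≤n t≤k alg = begin
  4 * n * D               ≤⟨ *-monoˡ-≤ D (4n≤5[n∸k∸t] n k t 100k≤n t≤k) ⟩
  5 * (n ∸ k ∸ t) * D     ≡⟨ *-assoc 5 (n ∸ k ∸ t) D ⟩
  5 * ((n ∸ k ∸ t) * D)   ≤⟨ *-monoʳ-≤ 5 (queries-≥-discoveries alg) ⟩
  5 * (2 * Q)             ≡⟨ *-assoc 5 2 Q ⟨
  10 * Q                  ∎
  where
  open ≤-Reasoning
  D Q : ℕ
  D = sumInj t (n ∸ k) (numDiscovered alg)
  Q = sumInj t (n ∸ k) (numQueries alg)

open import Data.Integer.Base as ℤ using (+_)
import Data.Integer.Properties as ℤ
open import Data.Rational using (ℚ; 0ℚ; _/_; _<_)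
open import Data.Rational as Q using ()
import Data.Rational.Properties as Q
open import Data.Rational.Unnormalised.Base as ℚᵘ using (mkℚᵘ; *≤*)
import Data.Rational.Unnormalised.Properties as ℚᵘ
open import Data.Rational.Solver using (module +-*-Solver)

scaled-fraction-≤ : ∀ c d n a b N → c * n * a ≤ suc d * b →
                    ((+ c) / suc d Q.* ℕtoℚ n) Q.* ((+ a) / suc N) Q.≤ (+ b) / suc N
scaled-fraction-≤ c d n a b N cna≤db = Q.toℚᵘ-cancel-≤
  (ℚᵘ.≤-respˡ-≃ (ℚᵘ.≃-sym lhs≃) (ℚᵘ.≤-respʳ-≃ (ℚᵘ.≃-sym (Q.toℚᵘ-fromℚᵘ (mkℚᵘ (+ b) N))) (*≤* (subst₂ ℤ._≤_ eqˡ eqʳ (ℤ.+≤+ cross)))))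
  where
  lhs≃ : Q.toℚᵘ (((+ c) / suc d Q.* ℕtoℚ n) Q.* ((+ a) / suc N)) ℚᵘ.≃ (mkℚᵘ (+ c) d ℚᵘ.* mkℚᵘ (+ n) 0) ℚᵘ.* mkℚᵘ (+ a) N
  lhs≃ = ℚᵘ.≃-trans (Q.toℚᵘ-homo-* ((+ c) / suc d Q.* ℕtoℚ n) ((+ a) / suc N)) (ℚᵘ.*-cong
           (ℚᵘ.≃-trans (Q.toℚᵘ-homo-* ((+ c) / suc d) (ℕtoℚ n)) (ℚᵘ.*-cong (Q.toℚᵘ-fromℚᵘ (mkℚᵘ (+ c) d)) (Q.toℚᵘ-fromℚᵘ (mkℚᵘ (+ n) 0))))
           (Q.toℚᵘ-fromℚᵘ (mkℚᵘ (+ a) N)))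
  -- suc d * 1 is the ℚᵘ denominator of (c / suc d) * (n / 1).
  cross : c * n * a * suc N ≤ b * (suc d * 1 * suc N)
  cross = begin
    c * n * a * suc N         ≤⟨ *-monoˡ-≤ (suc N) cna≤db ⟩
    suc d * b * suc N         ≡⟨ cong (_* suc N) (trans (*-comm (suc d) b) (cong (b *_) (sym (*-identityʳ (suc d))))) ⟩
    b * (suc d * 1) * suc N   ≡⟨ *-assoc b _ (suc N) ⟩
    b * (suc d * 1 * suc N)   ∎
    where open ≤-Reasoning
  eqˡ : + (c * n * a * suc N) ≡ (+ c ℤ.* + n) ℤ.* + a ℤ.* + suc N
  eqˡ = trans (ℤ.pos-* (c * n * a) (suc N)) (cong (ℤ._* + suc N) (trans (ℤ.pos-* (c * n) a) (cong (ℤ._* + a) (ℤ.pos-* c n))))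
  eqʳ : + (b * (suc d * 1 * suc N)) ≡ + b ℤ.* + (suc d * 1 * suc N)
  eqʳ = ℤ.pos-* b _

expect-scaled-≤ : ∀ {t m} (f g : Vec (Fin m) t → ℕ) c d n → c * n * sumInj t m f ≤ suc d * sumInj t m g →
                  ((+ c) / suc d Q.* ℕtoℚ n) Q.* expect t m f Q.≤ expect t m g
expect-scaled-≤ {t} {m} f g c d n cnf≤dg with length (injections t m)
... | zero  = Q.≤-reflexive (Q.*-zeroʳ ((+ c) / suc d Q.* ℕtoℚ n))
... | suc N = scaled-fraction-≤ c d n _ _ N cnf≤dg

expected-queries-≥ : ∀ (ε : ℚ) n k t → 100 * k ≤ n → t ≤ k → (alg : Alg (V' t (n ∸ k))) →
                     (ε Q.* ε Q.* ℕtoℚ k) Q.* ((+ 1) / 2) Q.≤ expect t (n ∸ k) (numDiscovered alg) →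
                     (+ 1) / 5 Q.* (ε Q.* ε Q.* ℕtoℚ n Q.* ℕtoℚ k) Q.≤ expect t (n ∸ k) (numQueries alg)
expected-queries-≥ ε n k t 100k≤n t≤k alg enough = begin
  (+ 1) / 5 Q.* (ε Q.* ε Q.* ℕtoℚ n Q.* ℕtoℚ k)         ≡⟨ rearrange ⟩
  scale Q.* (ε Q.* ε Q.* ℕtoℚ k Q.* ((+ 1) / 2))       ≤⟨ Q.*-monoˡ-≤-nonNeg scale {{scale≥0}} enough ⟩
  scale Q.* expect t (n ∸ k) (numDiscovered alg)       ≤⟨ expect-scaled-≤ (numDiscovered alg) (numQueries alg) 4 9 n (4n*discovered≤10*queries n k t 100k≤n t≤k alg) ⟩
  expect t (n ∸ k) (numQueries alg)                    ∎
  where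
  open Q.≤-Reasoning
  scale : ℚ
  scale = (+ 4) / 10 Q.* ℕtoℚ n
  scale≥0 : Q.NonNegative scale
  scale≥0 = Q.nonNeg*nonNeg⇒nonNeg ((+ 4) / 10) {{Q.normalize-nonNeg 4 10}} (ℕtoℚ n) {{Q.normalize-nonNeg n 1}}
  rearrange : (+ 1) / 5 Q.* (ε Q.* ε Q.* ℕtoℚ n Q.* ℕtoℚ k) ≡ scale Q.* (ε Q.* ε Q.* ℕtoℚ k Q.* ((+ 1) / 2))
  rearrange = solve 3 (λ e n k → con ((+ 1) / 5) :* (e :* e :* n :* k) := (con ((+ 4) / 10) :* n) :* (e :* e :* k :* con ((+ 1) / 2)))
                    refl ε (ℕtoℚ n) (ℕtoℚ k)
    where open +-*-Solver

lemma5p1 : ∃ λ (c : ℚ) → 0ℚ < c ×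
    ((ε : ℚ) → 0ℚ < ε → ε < (+ 1) / 3 →
     (n k : ℕ) → 100 * k ≤ n →
     (alg : Alg (V' (tOf ε k) (n ∸ k))) →
     (ε Q.* ε Q.* ℕtoℚ k) Q.* ((+ 1) / 2) Q.≤ expect (tOf ε k) (n ∸ k) (numDiscovered alg) →
     c Q.* (ε Q.* ε Q.* ℕtoℚ n Q.* ℕtoℚ k) Q.≤ expect (tOf ε k) (n ∸ k) (numQueries alg))
lemma5p1 = (+ 1) / 5 , Q.*<* (ℤ.+<+ (s≤s z≤n)) ,
  λ ε _ _ n k 100k≤n → expected-queries-≥ ε n k (tOf ε k) 100k≤n (div-≤ k (floorInv ε))
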